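{- Let $1\leq j<k<\omega$, let $l_0<\dots<l_{j-1}<k-1$ and $E=\{l_i:i<j\}$. Let $\{A_{\bar n}:\bar n\in\omega^j\}\subseteq[\omega]^\omega$. For $\bar m\in\omega^E$ let $$B_{\bar m}=\bigcap_{i_0\leq\bar m(l_0)}\ \bigcup_{i_1\leq\bar m(l_1)}\ \bigcap_{i_2\leq\bar m(l_2)}\cdots A_{(i_0,\dots,i_{j-1})}$$ (the operations alternate, starting with $\bigcap$, with $j$ operations in total). Then in $\mathcal{P}(\omega^k)/\mathcal{NC}^k$ the following equality holds (in particular the right-hand side exists): $$\coprod_{\bar m\in\omega^E}B_{\bar m}=\bigwedge_{n_0<\omega}\ \bigvee_{n_1<\omega}\ \bigwedge_{n_2<\omega}\cdots\ \omega^{k-1}\times A_{(n_0,\dots,n_{j-1})},$$ where the operations on the right alternate in the same pattern, starting with $\bigwedge$, with $j$ operations in total.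
   Context: The ideals $\mathrm{fin}^k$ on $\omega^k$: $\mathrm{fin}^1$ is the ideal of finite subsets of $\omega$, and for $k>1$, $\mathrm{fin}^k=\{A\subseteq\omega^k: A(n)\in\mathrm{fin}^{k-1}\text{ for all but finitely many } n\}$, where $A(n)=\{\bar x\in\omega^{k-1}:(n)^\frown\bar x\in A\}$; $A\subseteq_{\mathrm{fin}^k}B$ means $A\setminus B\in\mathrm{fin}^k$. For $k\geq2$, $\mathcal{NC}^k=\{A\subseteq\omega^k:\ \text{for all }(A_0,\dots,A_{k-2})\in([\omega]^\omega)^{k-1},\ \text{for all but finitely many } n,\ \prod_{i<k-1}A_i\not\subseteq_{\mathrm{fin}^{k-1}}A(n)\}$, an ideal on $\omega^k$; $\mathcal{P}(\omega^k)/\mathcal{NC}^k$ is the quotient Boolean algebra. Notation: for $E\subseteq k-1$ and sets $B_{\bar m}\subseteq\omega$ ($\bar m\in\omega^E$), $\coprod_{\bar m\in\omega^E}B_{\bar m}=\{\bar x\in\omega^k:\bar x(k-1)\in B_{\bar x\upharpoonright E}\}$. -}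

module Defs where

open import Data.Nat using (ℕ; zero; suc; _≤_; _<_)
open import Data.Fin using (Fin; fromℕ; inject₁)
open import Data.Vec using (Vec; []; _∷_; lookup; tabulate)
open import Data.Product using (Σ; ∃; _×_; _,_)
open import Data.Bool using (Bool; true; false)
open import Relation.Nullary using (¬_)

Sub : ℕ → Set₁
Sub k = Vec ℕ k → Set

Infinite : (ℕ → Set) → Set
Infinite A = ∀ N → ∃ λ n → N ≤ n × A n

section : ∀ {k} → Sub (suc k) → ℕ → Sub k
section A n xs = A (n ∷ xs)

-- FinIdeal k A  means  A ∈ fin^(k+1)  (A ⊆ ω^(k+1))
FinIdeal : (k : ℕ) → Sub (suc k) → Set
FinIdeal zero A = ∃ λ N → ∀ n → A (n ∷ []) → n < N
FinIdeal (suc k) A = ∃ λ N → ∀ n → N ≤ n → FinIdeal k (section A n)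

Diff : ∀ {k} → Sub k → Sub k → Sub k
Diff A B x = A x × ¬ B x

Prod : ∀ {K} → (Fin (suc K) → ℕ → Set) → Sub (suc K)
Prod F xs = ∀ i → F i (lookup xs i)

-- A ∈ NC^k  for k = K + 2
NC : (K : ℕ) → Sub (suc (suc K)) → Set₁
NC K A = (F : Fin (suc K) → ℕ → Set) → (∀ i → Infinite (F i)) →
  ∃ λ N → ∀ n → N ≤ n → ¬ FinIdeal K (Diff (Prod F) (section A n))

Leq : (K : ℕ) → Sub (suc (suc K)) → Sub (suc (suc K)) → Set₁
Leq K X Y = NC K (Diff X Y)

Eq : (K : ℕ) → Sub (suc (suc K)) → Sub (suc (suc K)) → Set₁
Eq K X Y = Leq K X Y × Leq K Y X

IsInf : (K : ℕ) → (ℕ → Sub (suc (suc K))) → Sub (suc (suc K)) → Set₁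
IsInf K Y X = (∀ n → Leq K X (Y n)) ×
  ((Z : Sub (suc (suc K))) → (∀ n → Leq K Z (Y n)) → Leq K Z X)

IsSup : (K : ℕ) → (ℕ → Sub (suc (suc K))) → Sub (suc (suc K)) → Set₁
IsSup K Y X = (∀ n → Leq K (Y n) X) ×
  ((Z : Sub (suc (suc K))) → (∀ n → Leq K (Y n) Z) → Leq K X Z)

-- ω^(k-1) × S  ⊆ ω^k : last coordinate in S
Base : (K : ℕ) → (ℕ → Set) → Sub (suc (suc K))
Base K S xs = S (lookup xs (fromℕ (suc K)))

-- Denotes K d b A X : in P(ω^k)/NC^k, [X] equals the alternating expression
--   ⋀_{n0} ⋁_{n1} ⋀_{n2} ⋯ ω^(k-1) × A(n0,…,n(d-1))   (b = true: start with ⋀)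
-- with d operations, all intermediate infima/suprema existing.
Denotes : (K d : ℕ) → Bool → (Vec ℕ d → ℕ → Set) → Sub (suc (suc K)) → Set₁
Denotes K zero b A X = Eq K X (Base K (A []))
Denotes K (suc d) true A X = Σ (ℕ → Sub (suc (suc K))) λ Y →
  (∀ n → Denotes K d false (λ ns → A (n ∷ ns)) (Y n)) × IsInf K Y X
Denotes K (suc d) false A X = Σ (ℕ → Sub (suc (suc K))) λ Y →
  (∀ n → Denotes K d true (λ ns → A (n ∷ ns)) (Y n)) × IsSup K Y X

Bset : (d : ℕ) → Bool → (Vec ℕ d → ℕ → Set) → Vec ℕ d → ℕ → Set
Bset zero b A [] x = A [] x
Bset (suc d) true A (m ∷ ms) x = ∀ i → i ≤ m → Bset d false (λ is → A (i ∷ is)) ms x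
Bset (suc d) false A (m ∷ ms) x = ∃ λ i → i ≤ m × Bset d true (λ is → A (i ∷ is)) ms x

-- ∐_{m̄ ∈ ω^E} B_m̄ with E = {l 0 < … < l (j-1)}, m̄ identified with (m̄(l 0),…,m̄(l (j-1)))
Coprod : (K : ℕ) → ∀ {j} → (Fin j → Fin (suc K)) → (Vec ℕ j → ℕ → Set) → Sub (suc (suc K))
Coprod K l B xs = B (tabulate (λ i → lookup xs (inject₁ (l i)))) (lookup xs (fromℕ (suc K)))

module Submission where

-- Put p = l 0. The set on the left of a
-- ⋀-step is ⋂_{i ≤ x_p} Y_i, where Y_i is the corresponding set for the remaining j - 1 operations
-- with first index i, and Y_i depends only on the coordinates after p; dually for a ⋁-step with
-- ⋃_{i ≤ x_p} Y_i. Since {x : x_p < n} ∈ NC^k, this set is a lower (upper) bound of the Y_n. It is the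
-- greatest (least) one because of the following fact: if every W ∩ C_i is in NC^k and the C_i depend
-- only on coordinates after p, then W ∩ ⋃_{i ≤ x_p} C_i is in NC^k. That fact rests on a partition
-- property of products of infinite sets modulo fin^k: if such a product is almost covered by finitely
-- many sets, or more generally by a union whose length is bounded by a function of the coordinates
-- before those on which the sets depend, then an infinite subproduct is almost contained in one of
-- them. The case of two sets is proved by induction on the dimension, by a fusion argument.

open import Defs
open import Level using (0ℓ; lift; lower) renaming (suc to lsuc)
open import Axiom.ExcludedMiddle using (ExcludedMiddle)
open import Axiom.DoubleNegationElimination using (em⇒dne)
open import Data.Nat using (ℕ; zero; suc; _≤_; _<_; z≤n; s≤s; s≤s⁻¹; _⊔_)
open import Data.Nat.Properties
open import Data.Fin using (Fin; zero; suc; toℕ; fromℕ; inject₁) renaming (_<_ to _<ᶠ_)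
open import Data.Fin.Properties using (toℕ-inject₁; toℕ-fromℕ; toℕ<n; toℕ≤pred[n])
open import Data.Vec using (Vec; []; _∷_; lookup; replicate)
open import Data.Vec.Properties using (tabulate-cong)
open import Data.Bool using (Bool; true; false)
open import Data.Bool.Properties using (¬-not)
open import Data.Product
open import Data.Sum using (_⊎_; inj₁; inj₂; [_,_])
open import Data.Empty using (⊥-elim)
open import Function using (_∘_)
open import Relation.Nullary
open import Relation.Nullary.Decidable using (map′)
open import Relation.Binary.PropositionalEquality using (_≡_; refl; sym; subst; subst₂)

infix 4 _⊆_ _⊆ᶠ_ _⊑_
infixr 5 _◃_
infixr 6 _∪_ _∩_

_⊆_ : ∀ {k} → Sub k → Sub k → Set
X ⊆ Y = ∀ x → X x → Y x

_∪_ : ∀ {k} → Sub k → Sub k → Sub k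
(X ∪ Y) x = X x ⊎ Y x

_∩_ : ∀ {k} → Sub k → Sub k → Sub k
(X ∩ Y) x = X x × Y x

⋃ : ∀ {k} {I : Set} → (I → Sub k) → Sub k
⋃ C x = ∃ λ i → C i x

⋃≤ : ∀ {k} → (ℕ → Sub k) → (Vec ℕ k → ℕ) → Sub k
⋃≤ C β x = ∃ λ i → i ≤ β x × C i x

⋂≤ : ∀ {k} → (ℕ → Sub k) → (Vec ℕ k → ℕ) → Sub k
⋂≤ C β x = ∀ i → i ≤ β x → C i x

_⊆ᶠ_ : ∀ {k} → Sub (suc k) → Sub (suc k) → Set
X ⊆ᶠ Y = FinIdeal _ (Diff X Y)

SomeCoordinateBelow : ∀ {k} → (Fin (suc k) → ℕ) → Sub (suc k)
SomeCoordinateBelow M y = ∃ λ t → lookup y t < M t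

finIdeal-mono : ∀ {k} {A B : Sub (suc k)} → A ⊆ B → FinIdeal k B → FinIdeal k A
finIdeal-mono {zero} A⊆B (N , bounded) = N , λ n a → bounded n (A⊆B _ a)
finIdeal-mono {suc k} A⊆B (N , small) = N , λ n N≤n → finIdeal-mono (λ ys → A⊆B (n ∷ ys)) (small n N≤n)

finIdeal-empty : ∀ {k} {A : Sub (suc k)} → (∀ x → ¬ A x) → FinIdeal k A
finIdeal-empty {zero} empty = 0 , λ _ a → ⊥-elim (empty _ a)
finIdeal-empty {suc k} empty = 0 , λ n _ → finIdeal-empty (λ ys → empty (n ∷ ys))

finIdeal-∪ : ∀ {k} {A B : Sub (suc k)} → FinIdeal k A → FinIdeal k B → FinIdeal k (A ∪ B)
finIdeal-∪ {zero} (N , boundedA) (M , boundedB) = N ⊔ M , λ n →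
  [ (λ a → <-≤-trans (boundedA n a) (m≤m⊔n N M)) , (λ b → <-≤-trans (boundedB n b) (m≤n⊔m N M)) ]
finIdeal-∪ {suc k} (N , smallA) (M , smallB) = N ⊔ M , λ n N⊔M≤n →
  finIdeal-∪ (smallA n (m⊔n≤o⇒m≤o N M N⊔M≤n)) (smallB n (m⊔n≤o⇒n≤o N M N⊔M≤n))

SomeCoordinateBelow-finIdeal : ∀ {k} (M : Fin (suc k) → ℕ) → FinIdeal k (SomeCoordinateBelow M)
SomeCoordinateBelow-finIdeal {zero} M = M zero , λ { n (zero , n<M) → n<M }
SomeCoordinateBelow-finIdeal {suc k} M = M zero , λ n M≤n →
  finIdeal-mono (λ _ → λ { (zero , n<M) → ⊥-elim (≤⇒≯ M≤n n<M) ; (suc t , y<M) → t , y<M })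
    (SomeCoordinateBelow-finIdeal (M ∘ suc))

⊆ᶠ-mono : ∀ {k} {X X' C C' : Sub (suc k)} → X' ⊆ X → C ⊆ C' → X ⊆ᶠ C → X' ⊆ᶠ C'
⊆ᶠ-mono X'⊆X C⊆C' = finIdeal-mono λ x (x∈X' , x∉C') → X'⊆X x x∈X' , x∉C' ∘ C⊆C' x

-- Products of infinite sets

Factors : ℕ → Set₁
Factors k = Fin (suc k) → ℕ → Set

InfiniteFactors : ∀ {k} → Factors k → Set
InfiniteFactors F = ∀ t → Infinite (F t)

record _⊑_ {k} (F' F : Factors k) : Set where
  field
    factor-⊆ : ∀ t {n} → F' t n → F t n
    infinite : InfiniteFactors F'

open _⊑_

⊑-refl : ∀ {k} {F : Factors k} → InfiniteFactors F → F ⊑ F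
⊑-refl inf = record { factor-⊆ = λ _ n∈F → n∈F ; infinite = inf }

⊑-trans : ∀ {k} {F'' F' F : Factors k} → F'' ⊑ F' → F' ⊑ F → F'' ⊑ F
⊑-trans F''⊑F' F'⊑F = record
  { factor-⊆ = λ t → factor-⊆ F'⊑F t ∘ factor-⊆ F''⊑F' t ; infinite = infinite F''⊑F' }

_◃_ : ∀ {k} → (ℕ → Set) → Factors k → Factors (suc k)
(S ◃ F) zero = S
(S ◃ F) (suc t) = F t

◃-⊑ : ∀ {k} {S : ℕ → Set} {R : Factors k} {F : Factors (suc k)} →
  (∀ {n} → S n → F zero n) → Infinite S → R ⊑ F ∘ suc → S ◃ R ⊑ F
◃-⊑ S⊆F₀ infS R⊑F = record
  { factor-⊆ = λ { zero → S⊆F₀ ; (suc t) → factor-⊆ R⊑F t }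
  ; infinite = λ { zero → infS ; (suc t) → infinite R⊑F t } }

Prod-mono : ∀ {k} {F' F : Factors k} → F' ⊑ F → Prod F' ⊆ Prod F
Prod-mono F'⊑F _ x∈F' t = factor-⊆ F'⊑F t (x∈F' t)

Prod-∷ : ∀ {k} {F : Factors (suc k)} {n ys} → F zero n → Prod (F ∘ suc) ys → Prod F (n ∷ ys)
Prod-∷ n∈F ys∈F zero = n∈F
Prod-∷ n∈F ys∈F (suc t) = ys∈F t

section-⊆ᶠ : ∀ {k} {F : Factors (suc k)} {C : Sub (suc (suc k))} {n} → F zero n →
  FinIdeal k (section (Diff (Prod F) C) n) → Prod (F ∘ suc) ⊆ᶠ section C n
section-⊆ᶠ {F = F} n∈F = finIdeal-mono λ _ (ys∈F , ∉C) → Prod-∷ {F = F} n∈F ys∈F , ∉C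

Prod-∉-finIdeal : ∀ {k} (F : Factors k) → InfiniteFactors F → ¬ FinIdeal k (Prod F)
Prod-∉-finIdeal {zero} F inf (N , bounded) with inf zero N
... | n , N≤n , n∈F = ≤⇒≯ N≤n (bounded n λ { zero → n∈F })
Prod-∉-finIdeal {suc k} F inf (N , small) with inf zero N
... | n , N≤n , n∈F =
  Prod-∉-finIdeal (F ∘ suc) (inf ∘ suc) (finIdeal-mono (λ _ → Prod-∷ {F = F} n∈F) (small n N≤n))

Infinite-∩-≥ : ∀ {S : ℕ → Set} n → Infinite S → Infinite (λ y → S y × n ≤ y)
Infinite-∩-≥ n inf M with inf (n ⊔ M)
... | y , n⊔M≤y , y∈S = y , m⊔n≤o⇒n≤o n M n⊔M≤y , y∈S , m⊔n≤o⇒m≤o n M n⊔M≤y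

module _ {a ℓ} {A : Set a} (_∼_ : A → A → Set ℓ) (∼-refl : ∀ {x} → x ∼ x)
  (∼-trans : ∀ {x y z} → x ∼ y → y ∼ z → x ∼ z) (f : ℕ → A) (step : ∀ i → f i ∼ f (suc i)) where

  stepwise⇒≤-related : ∀ {i j} → i ≤ j → f i ∼ f j
  stepwise⇒≤-related {j = zero} z≤n = ∼-refl
  stepwise⇒≤-related {j = suc j} i≤1+j with m≤n⇒m<n∨m≡n i≤1+j
  ... | inj₁ i<1+j = ∼-trans (stepwise⇒≤-related (s≤s⁻¹ i<1+j)) (step j)
  ... | inj₂ refl = ∼-refl

module _ (f : ℕ → ℕ) (step : ∀ i → f i < f (suc i)) where

  stepwise-<⇒< : ∀ {i j} → i < j → f i < f j
  stepwise-<⇒< {i} i<j = <-≤-trans (step i) (stepwise⇒≤-related _≤_ ≤-refl ≤-trans f (<⇒≤ ∘ step) i<j)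

  stepwise-<⇒≤-reflecting : ∀ {i j} → f i ≤ f j → i ≤ j
  stepwise-<⇒≤-reflecting fi≤fj = ≮⇒≥ λ j<i → ≤⇒≯ fi≤fj (stepwise-<⇒< j<i)

  stepwise-<⇒≥id : ∀ i → i ≤ f i
  stepwise-<⇒≥id zero = z≤n
  stepwise-<⇒≥id (suc i) = ≤-<-trans (stepwise-<⇒≥id i) (step i)

module _ (S : ℕ → ℕ → Set) (infS : ∀ i → Infinite (S i)) where

  increasingChoice : ℕ → ℕ
  increasingChoice zero = proj₁ (infS 0 0)
  increasingChoice (suc i) = proj₁ (infS (suc i) (suc (increasingChoice i)))

  increasingChoice-< : ∀ i → increasingChoice i < increasingChoice (suc i)
  increasingChoice-< i = proj₁ (proj₂ (infS (suc i) (suc (increasingChoice i))))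

  increasingChoice-∈ : ∀ i → S i (increasingChoice i)
  increasingChoice-∈ zero = proj₂ (proj₂ (infS 0 0))
  increasingChoice-∈ (suc i) = proj₂ (proj₂ (infS (suc i) (suc (increasingChoice i))))

AgreeBelow AgreeFrom : ∀ {k} → ℕ → Vec ℕ k → Vec ℕ k → Set
AgreeBelow r x x' = ∀ t → toℕ t < r → lookup x t ≡ lookup x' t
AgreeFrom r x x' = ∀ t → r ≤ toℕ t → lookup x t ≡ lookup x' t

DependsOnlyBelow : ∀ {k} → ℕ → (Vec ℕ k → ℕ) → Set
DependsOnlyBelow r β = ∀ x x' → AgreeBelow r x x' → β x ≡ β x'

DependsOnlyFrom : ∀ {k} → ℕ → Sub k → Set
DependsOnlyFrom r C = ∀ x x' → AgreeFrom r x x' → C x → C x'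

∷-agreeBelow : ∀ {k r n} {ys ys' : Vec ℕ k} → AgreeBelow r ys ys' → AgreeBelow (suc r) (n ∷ ys) (n ∷ ys')
∷-agreeBelow agree zero _ = refl
∷-agreeBelow agree (suc t) t<1+r = agree t (s≤s⁻¹ t<1+r)

∷-agreeFrom : ∀ {k r m n} {ys ys' : Vec ℕ k} → AgreeFrom r ys ys' → AgreeFrom (suc r) (m ∷ ys) (n ∷ ys')
∷-agreeFrom agree zero ()
∷-agreeFrom agree (suc t) 1+r≤t = agree t (s≤s⁻¹ 1+r≤t)

dependsOnlyFrom-∁ : ∀ {k r} {C : Sub k} → DependsOnlyFrom r C → DependsOnlyFrom r (λ x → ¬ C x)
dependsOnlyFrom-∁ C-local x x' agree x∉C x'∈C = x∉C (C-local x' x (λ t r≤t → sym (agree t r≤t)) x'∈C)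

coordinate : ∀ {K} → Fin (suc K) → Vec ℕ (suc (suc K)) → ℕ
coordinate p x = lookup x (inject₁ p)

coordinate-dependsOnlyBelow : ∀ {K} n (p : Fin (suc K)) →
  DependsOnlyBelow (toℕ p) (λ ys → coordinate p (n ∷ ys))
coordinate-dependsOnlyBelow n zero _ _ _ = refl
coordinate-dependsOnlyBelow n (suc p) _ _ agree = agree (inject₁ p) (s≤s (≤-reflexive (toℕ-inject₁ p)))

StrictlyIncreasing : ∀ {j K} → (Fin j → Fin (suc K)) → Set
StrictlyIncreasing l = ∀ a b → a <ᶠ b → l a <ᶠ l b

strictlyIncreasing-tail : ∀ {j K} {l : Fin (suc j) → Fin (suc K)} →
  StrictlyIncreasing l → StrictlyIncreasing (l ∘ suc)
strictlyIncreasing-tail l-increasing a b a<b = l-increasing (suc a) (suc b) (s≤s a<b)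

Coprod-tail-dependsOnlyFrom : ∀ K {d} (l : Fin (suc d) → Fin (suc K)) → StrictlyIncreasing l →
  (B : Vec ℕ d → ℕ → Set) → DependsOnlyFrom (suc (toℕ (l zero))) (Coprod K (l ∘ suc) B)
Coprod-tail-dependsOnlyFrom K l l-increasing B x x' agree = subst₂ B
  (tabulate-cong λ s → agree (inject₁ (l (suc s)))
    (<-≤-trans (l-increasing zero (suc s) (s≤s z≤n)) (≤-reflexive (sym (toℕ-inject₁ (l (suc s)))))))
  (agree (fromℕ (suc K)) (<-≤-trans (toℕ<n (l zero)) (≤-reflexive (sym (toℕ-fromℕ (suc K))))))

-- The ideal NC^k

NC-mono : ∀ {K} (U V : Sub (suc (suc K))) → U ⊆ V → NC K V → NC K U
NC-mono U V U⊆V V∈NC F inf with V∈NC F inf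
... | N , large = N , λ n N≤n small → large n N≤n (⊆ᶠ-mono (λ _ x → x) (λ ys → U⊆V (n ∷ ys)) small)

coordinate<-NC : ∀ K (p : Fin (suc (suc K))) n → NC K (λ x → lookup x p < n)
coordinate<-NC K zero n F inf = n , λ m n≤m small →
  Prod-∉-finIdeal F inf (finIdeal-mono (λ _ x∈F → x∈F , ≤⇒≯ n≤m) small)
coordinate<-NC K (suc p) n F inf = 0 , λ _ _ small →
  Prod-∉-finIdeal (λ t y → F t y × n ≤ y) (Infinite-∩-≥ n ∘ inf)
    (finIdeal-mono (λ _ x∈F≥n → proj₁ ∘ x∈F≥n , ≤⇒≯ (proj₂ (x∈F≥n p))) small)

Leq-refl : ∀ K {X : Sub (suc (suc K))} → Leq K X X
Leq-refl K F inf = 0 , λ _ _ small →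
  Prod-∉-finIdeal F inf (finIdeal-mono (λ _ x∈F → x∈F , λ (x∈X , x∉X) → x∉X x∈X) small)

module Classical (em : ExcludedMiddle 0ℓ) where

  dne : {P : Set} → ¬ ¬ P → P
  dne = em⇒dne em

  ¬∀⇒∃¬ : {I : Set} {Q : I → Set} → ¬ (∀ i → Q i) → ∃ λ i → ¬ Q i
  ¬∀⇒∃¬ ¬∀ = dne λ ¬∃ → ¬∀ λ i → dne λ ¬Q → ¬∃ (i , ¬Q)

  ¬∀≤⇒∃≤¬ : ∀ {m} {Q : ℕ → Set} → ¬ (∀ i → i ≤ m → Q i) → ∃ λ i → i ≤ m × ¬ Q i
  ¬∀≤⇒∃≤¬ ¬∀ with ¬∀⇒∃¬ ¬∀
  ... | i , ¬[i≤m→Q] = i , dne (λ i≰m → ¬[i≤m→Q] (⊥-elim ∘ i≰m)) , λ q → ¬[i≤m→Q] λ _ → q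

  ¬Infinite⇒eventually¬ : {Q : ℕ → Set} → ¬ Infinite Q → ∃ λ N → ∀ n → N ≤ n → ¬ Q n
  ¬Infinite⇒eventually¬ ¬inf with ¬∀⇒∃¬ ¬inf
  ... | N , ¬∃ = N , λ n N≤n q → ¬∃ (n , N≤n , q)

  ¬eventually¬⇒Infinite : {Q : ℕ → Set} → ¬ (∃ λ N → ∀ n → N ≤ n → ¬ Q n) → Infinite Q
  ¬eventually¬⇒Infinite ¬ev N = dne λ ¬∃ → ¬ev (N , λ n N≤n q → ¬∃ (n , N≤n , q))

  pigeonhole : (c : ℕ → Bool) → ∃ λ b → Infinite (λ i → c i ≡ b)
  pigeonhole c with em {Infinite (λ i → c i ≡ true)}
  ... | yes inf = true , inf
  ... | no ¬inf with ¬Infinite⇒eventually¬ ¬inf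
  ... | N , ¬true = false , λ M → N ⊔ M , m≤n⊔m N M , ¬-not (¬true (N ⊔ M) (m≤m⊔n N M))

  ⊆ᶠ-bySections : ∀ {k} {F : Factors (suc k)} {C : Sub (suc (suc k))} →
    (∀ {n} → F zero n → Prod (F ∘ suc) ⊆ᶠ section C n) → Prod F ⊆ᶠ C
  ⊆ᶠ-bySections {k} {F} {C} sections = 0 , λ n _ → sectionAt n (em {F zero n})
    where
    sectionAt : ∀ n → Dec (F zero n) → FinIdeal k (section (Diff (Prod F) C) n)
    sectionAt n (yes n∈F) = finIdeal-mono (λ _ (ys∈F , ∉C) → (λ t → ys∈F (suc t)) , ∉C) (sections n∈F)
    sectionAt n (no n∉F) = finIdeal-empty λ _ (ys∈F , _) → n∉F (ys∈F zero)

-- The partition property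

Partition₂ : ℕ → Set₁
Partition₂ k = (F : Factors k) → InfiniteFactors F → (C : Bool → Sub (suc k)) →
  Prod F ⊆ᶠ ⋃ C → ∃₂ λ F' b → F' ⊑ F × Prod F' ⊆ᶠ C b

restrict₀ : Factors 0 → Sub 1 → Factors 0
restrict₀ F C t n = F t n × C (n ∷ [])

restrict₀-⊑ : ∀ {F} C → Infinite (λ n → F zero n × C (n ∷ [])) → restrict₀ F C ⊑ F
restrict₀-⊑ C inf = record { factor-⊆ = λ _ → proj₁ ; infinite = λ { zero → inf } }

restrict₀-⊆ᶠ : ∀ {F} C → Prod (restrict₀ F C) ⊆ᶠ C
restrict₀-⊆ᶠ {F} C =
  finIdeal-empty {A = Diff (Prod (restrict₀ F C)) C} λ { (n ∷ []) (x∈F , ∉C) → ∉C (proj₂ (x∈F zero)) }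

earlierOrLast : ∀ {k} → (ℕ → Sub k) → ℕ → Bool → Sub k
earlierOrLast C M true = ⋃≤ C (λ _ → M)
earlierOrLast C M false = C (suc M)

⋃≤-suc : ∀ {k} (C : ℕ → Sub k) M → ⋃≤ C (λ _ → suc M) ⊆ ⋃ (earlierOrLast C M)
⋃≤-suc C M x (i , i≤1+M , c) with m≤n⇒m<n∨m≡n i≤1+M
... | inj₁ i<1+M = true , i , s≤s⁻¹ i<1+M , c
... | inj₂ refl = false , c

module PartitionProperty (em : ExcludedMiddle 0ℓ) where

  open Classical em

  partition₂-base : Partition₂ 0
  partition₂-base F inf C (N , bounded) with em {Infinite (λ n → F zero n × C true (n ∷ []))}
  ... | yes inf-true = restrict₀ F (C true) , true , restrict₀-⊑ (C true) inf-true , restrict₀-⊆ᶠ {F} (C true)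
  ... | no ¬inf-true with ¬Infinite⇒eventually¬ ¬inf-true
  ... | N₀ , ∉C-true = restrict₀ F (C false) , false , restrict₀-⊑ (C false) inf-false , restrict₀-⊆ᶠ {F} (C false)
    where
    inf-false : Infinite (λ n → F zero n × C false (n ∷ []))
    inf-false M with inf zero (N ⊔ N₀ ⊔ M)
    ... | n , le , n∈F = n , m⊔n≤o⇒n≤o (N ⊔ N₀) M le , n∈F , dne λ ∉C-false →
      ≤⇒≯ (m⊔n≤o⇒m≤o N N₀ (m⊔n≤o⇒m≤o (N ⊔ N₀) M le))
        (bounded n ((λ { zero → n∈F }) , λ where
          (true , c) → ∉C-true n (m⊔n≤o⇒n≤o N N₀ (m⊔n≤o⇒m≤o (N ⊔ N₀) M le)) (n∈F , c)
          (false , c) → ∉C-false c))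

  -- Fusion: pick a₀ < a₁ < … in F 0 and shrinking subproducts R₀ ⊒ R₁ ⊒ … of the remaining factors,
  -- R_i almost inside the section at a_i of one colour (the induction hypothesis). Keep the a_i whose
  -- colour occurs infinitely often, and diagonalise the R_i: the i-th elements of the new factors lie
  -- in R_i, so every point of the new product lying above them in all coordinates lies in ∏ R_i.
  module PartitionStep {k} (partition₂ₖ : Partition₂ k) (F : Factors (suc k)) (inf : InfiniteFactors F)
    (C : Bool → Sub (suc (suc k))) (N : ℕ)
    (covered : ∀ n → N ≤ n → FinIdeal k (section (Diff (Prod F) (⋃ C)) n)) where

    record Stage : Set₁ where
      field
        R : Factors k
        R⊑ : R ⊑ F ∘ suc
        a : ℕ
        a∈F₀ : F zero a
        colour : Bool
        homogeneous : Prod R ⊆ᶠ section (C colour) a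

    open Stage

    nextStage : (P : Factors k) → P ⊑ F ∘ suc → (L : ℕ) → Σ Stage λ s → R s ⊑ P × L ≤ a s
    nextStage P P⊑ L with inf zero (N ⊔ L)
    ... | n , N⊔L≤n , n∈F₀
        with partition₂ₖ P (infinite P⊑) (λ b → section (C b) n)
               (⊆ᶠ-mono (Prod-mono P⊑) (λ _ c → c)
                 (section-⊆ᶠ {F = F} {C = ⋃ C} n∈F₀ (covered n (m⊔n≤o⇒m≤o N L N⊔L≤n))))
    ... | P' , b , P'⊑P , P'-homogeneous =
      record { R = P' ; R⊑ = ⊑-trans P'⊑P P⊑ ; a = n ; a∈F₀ = n∈F₀ ; colour = b ; homogeneous = P'-homogeneous } ,
      P'⊑P , m⊔n≤o⇒n≤o N L N⊔L≤n

    stage : ℕ → Stage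
    stage zero = proj₁ (nextStage (F ∘ suc) (⊑-refl (inf ∘ suc)) 0)
    stage (suc i) = proj₁ (nextStage (R (stage i)) (R⊑ (stage i)) (suc (a (stage i))))

    stage-⊑ : ∀ i → R (stage (suc i)) ⊑ R (stage i)
    stage-⊑ i = proj₁ (proj₂ (nextStage (R (stage i)) (R⊑ (stage i)) (suc (a (stage i)))))

    stage-a-< : ∀ i → a (stage i) < a (stage (suc i))
    stage-a-< i = proj₂ (proj₂ (nextStage (R (stage i)) (R⊑ (stage i)) (suc (a (stage i)))))

    stage-R-antitone : ∀ {i j} → i ≤ j → ∀ t {y} → R (stage j) t y → R (stage i) t y
    stage-R-antitone = stepwise⇒≤-related (λ R R' → ∀ t {y} → R' t y → R t y)
      (λ _ r → r) (λ p q t → p t ∘ q t) (R ∘ stage) (factor-⊆ ∘ stage-⊑)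

    diagonal : Fin (suc k) → ℕ → ℕ
    diagonal t = increasingChoice (λ i → R (stage i) t) (λ i → infinite (R⊑ (stage i)) t)

    diagonal-< : ∀ t i → diagonal t i < diagonal t (suc i)
    diagonal-< t = increasingChoice-< (λ i → R (stage i) t) (λ i → infinite (R⊑ (stage i)) t)

    diagonal-∈ : ∀ t i → R (stage i) t (diagonal t i)
    diagonal-∈ t = increasingChoice-∈ (λ i → R (stage i) t) (λ i → infinite (R⊑ (stage i)) t)

    frequentColour : Bool
    frequentColour = proj₁ (pigeonhole (colour ∘ stage))

    fused : Factors (suc k)
    fused = (λ n → ∃ λ i → a (stage i) ≡ n × colour (stage i) ≡ frequentColour)
          ◃ (λ t y → ∃ λ i → diagonal t i ≡ y)

    fused⊑F : fused ⊑ F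
    fused⊑F = ◃-⊑ (λ { (i , refl , _) → a∈F₀ (stage i) }) infinite₀ (record
      { factor-⊆ = λ { t (i , refl) → factor-⊆ (R⊑ (stage i)) t (diagonal-∈ t i) }
      ; infinite = λ t M → diagonal t M , stepwise-<⇒≥id (diagonal t) (diagonal-< t) M , M , refl })
      where
      infinite₀ : Infinite (fused zero)
      infinite₀ M with proj₂ (pigeonhole (colour ∘ stage)) M
      ... | i , M≤i , colour≡c =
        a (stage i) , ≤-trans M≤i (stepwise-<⇒≥id (a ∘ stage) stage-a-< i) , i , refl , colour≡c

    fused-inStage : ∀ i {ys} → Prod (fused ∘ suc) ys →
      ¬ SomeCoordinateBelow (λ t → diagonal t i) ys → Prod (R (stage i)) ys
    fused-inStage i ys∈fused ¬below t with ys∈fused t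
    ... | j , diagonal≡y = subst (R (stage i) t) diagonal≡y
      (stage-R-antitone {i} {j} (stepwise-<⇒≤-reflecting (diagonal t) (diagonal-< t) {i} {j}
        (subst (diagonal t i ≤_) (sym diagonal≡y) (≮⇒≥ λ y<d → ¬below (t , y<d)))) t (diagonal-∈ t j))

    fused-homogeneous : Prod fused ⊆ᶠ C frequentColour
    fused-homogeneous = ⊆ᶠ-bySections {F = fused} {C = C frequentColour} λ { (i , refl , colour≡c) →
      finIdeal-mono (split i colour≡c)
        (finIdeal-∪ (SomeCoordinateBelow-finIdeal (λ t → diagonal t i)) (homogeneous (stage i))) }
      where
      split : ∀ i → colour (stage i) ≡ frequentColour →
        Diff (Prod (fused ∘ suc)) (section (C frequentColour) (a (stage i))) ⊆
        SomeCoordinateBelow (λ t → diagonal t i) ∪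
        Diff (Prod (R (stage i))) (section (C (colour (stage i))) (a (stage i)))
      split i colour≡c ys (ys∈fused , ∉C) with em {SomeCoordinateBelow (λ t → diagonal t i) ys}
      ... | yes below = inj₁ below
      ... | no ¬below = inj₂ (fused-inStage i {ys} ys∈fused ¬below ,
                              subst (λ b → ¬ C b (a (stage i) ∷ ys)) (sym colour≡c) ∉C)

  partition₂ : ∀ k → Partition₂ k
  partition₂ zero = partition₂-base
  partition₂ (suc k) F inf C (N , covered) = fused , frequentColour , fused⊑F , fused-homogeneous
    where open PartitionStep (partition₂ k) F inf C N covered

  partition-⋃≤ : ∀ {k} M (F : Factors k) → InfiniteFactors F → (C : ℕ → Sub (suc k)) →
    Prod F ⊆ᶠ ⋃≤ C (λ _ → M) → ∃₂ λ i F' → F' ⊑ F × Prod F' ⊆ᶠ C i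
  partition-⋃≤ zero F inf C covered =
    0 , F , ⊑-refl inf , ⊆ᶠ-mono (λ _ x → x) (λ { _ (.0 , z≤n , c) → c }) covered
  partition-⋃≤ (suc M) F inf C covered
      with partition₂ _ F inf (earlierOrLast C M) (⊆ᶠ-mono (λ _ x → x) (⋃≤-suc C M) covered)
  ... | F' , false , F'⊑F , F'-homogeneous = suc M , F' , F'⊑F , F'-homogeneous
  ... | F' , true , F'⊑F , F'-homogeneous with partition-⋃≤ M F' (infinite F'⊑F) C F'-homogeneous
  ... | i , F'' , F''⊑F' , F''-homogeneous = i , F'' , ⊑-trans F''⊑F' F'⊑F , F''-homogeneous

  -- Fixing the first r coordinates one at a time makes the bound β constant.
  partition-⋃≤-local : ∀ {k} r → r ≤ k → (F : Factors k) → InfiniteFactors F →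
    (β : Vec ℕ (suc k) → ℕ) → DependsOnlyBelow r β →
    (C : ℕ → Sub (suc k)) → (∀ i → DependsOnlyFrom r (C i)) →
    Prod F ⊆ᶠ ⋃≤ C β → ∃₂ λ i F' → F' ⊑ F × Prod F' ⊆ᶠ C i
  partition-⋃≤-local {k} zero _ F inf β β-constant C _ covered =
    partition-⋃≤ (β x₀) F inf C (⊆ᶠ-mono (λ _ x → x) bound-x₀ covered)
    where
    x₀ : Vec ℕ (suc k)
    x₀ = replicate _ 0
    bound-x₀ : ⋃≤ C β ⊆ ⋃≤ C (λ _ → β x₀)
    bound-x₀ x (i , i≤β , c) = i , subst (i ≤_) (β-constant x x₀ λ _ ()) i≤β , c
  partition-⋃≤-local {zero} (suc r) ()
  partition-⋃≤-local {suc k} (suc r) r≤k F inf β β-local C C-local (N , covered) with inf zero N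
  ... | n , N≤n , n∈F₀
      with partition-⋃≤-local r (s≤s⁻¹ r≤k) (F ∘ suc) (inf ∘ suc)
             (λ ys → β (n ∷ ys)) (λ ys ys' → β-local _ _ ∘ ∷-agreeBelow)
             (λ i ys → C i (n ∷ ys)) (λ i ys ys' → C-local i _ _ ∘ ∷-agreeFrom)
             (section-⊆ᶠ {F = F} {C = ⋃≤ C β} n∈F₀ (covered n N≤n))
  ... | i , R , R⊑ , R-homogeneous =
    i , F zero ◃ R , ◃-⊑ (λ x → x) (inf zero) R⊑ ,
    ⊆ᶠ-bySections {F = F zero ◃ R} {C = C i} λ _ →
      ⊆ᶠ-mono (λ _ x → x) (λ ys → C-local i _ _ (∷-agreeFrom λ _ _ → refl)) R-homogeneous

-- Infima and suprema in P(ω^k)/NC^k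

module InfSup (em : ExcludedMiddle 0ℓ) where

  open Classical em
  open PartitionProperty em

  -- If not, some product of infinite sets is almost covered by the sections of W ∩ ⋃≤ at infinitely
  -- many n. At one of them, n₀, the partition property yields i and a subproduct almost inside the
  -- section of C i at n₀; as C i ignores the first coordinate, this subproduct is almost inside the
  -- section of W ∩ C i at every other such n, contradicting W ∩ C i ∈ NC.
  ⋃≤-NC : ∀ K (p : Fin (suc K)) (W : Sub (suc (suc K))) (C : ℕ → Sub (suc (suc K))) →
    (∀ i → DependsOnlyFrom (suc (toℕ p)) (C i)) → (∀ i → NC K (W ∩ C i)) → NC K (W ∩ ⋃≤ C (coordinate p))
  ⋃≤-NC K p W C C-local W∩C-NC F inf
      with em {∃ λ N → ∀ n → N ≤ n → ¬ Prod F ⊆ᶠ section (W ∩ ⋃≤ C (coordinate p)) n}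
  ... | yes eventually = eventually
  ... | no ¬eventually with ¬eventually¬⇒Infinite ¬eventually 0
  ... | n₀ , _ , covered₀
      with partition-⋃≤-local (toℕ p) (toℕ≤pred[n] p) F inf
             (λ ys → coordinate p (n₀ ∷ ys)) (coordinate-dependsOnlyBelow n₀ p)
             (λ i ys → C i (n₀ ∷ ys)) (λ i ys ys' → C-local i _ _ ∘ ∷-agreeFrom)
             (⊆ᶠ-mono (λ _ x → x) (λ _ → proj₂) covered₀)
  ... | i , F' , F'⊑F , F'-homogeneous with W∩C-NC i F' (infinite F'⊑F)
  ... | N , large with ¬eventually¬⇒Infinite ¬eventually N
  ... | n , N≤n , coveredₙ =
    ⊥-elim (large n N≤n (finIdeal-mono moveSection (finIdeal-∪ coveredₙ F'-homogeneous)))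
    where
    moveSection : Diff (Prod F') (section (W ∩ C i) n) ⊆
      Diff (Prod F) (section (W ∩ ⋃≤ C (coordinate p)) n) ∪ Diff (Prod F') (section (C i) n₀)
    moveSection ys (ys∈F' , ∉W∩C) with em {(W ∩ ⋃≤ C (coordinate p)) (n ∷ ys)}
    ... | no ∉U = inj₁ (Prod-mono F'⊑F ys ys∈F' , ∉U)
    ... | yes (w , _) = inj₂ (ys∈F' , λ c → ∉W∩C (w , C-local i _ _ (∷-agreeFrom λ _ _ → refl) c))

  ⋂≤-isInf : ∀ K (p : Fin (suc K)) (Y : ℕ → Sub (suc (suc K))) →
    (∀ i → DependsOnlyFrom (suc (toℕ p)) (Y i)) → IsInf K Y (⋂≤ Y (coordinate p))
  ⋂≤-isInf K p Y Y-local = lowerBound , greatest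
    where
    ⋂Y : Sub (suc (suc K))
    ⋂Y = ⋂≤ Y (coordinate p)
    lowerBound : ∀ n → Leq K ⋂Y (Y n)
    lowerBound n = NC-mono (Diff ⋂Y (Y n)) (λ x → coordinate p x < n)
      (λ _ (x∈⋂ , x∉Y) → ≰⇒> λ n≤x → x∉Y (x∈⋂ n n≤x)) (coordinate<-NC K (inject₁ p) n)
    greatest : ∀ Z → (∀ n → Leq K Z (Y n)) → Leq K Z ⋂Y
    greatest Z Z≤Y = NC-mono (Diff Z ⋂Y) (Z ∩ ⋃≤ (λ i x → ¬ Y i x) (coordinate p))
      (λ _ (z , x∉⋂) → z , ¬∀≤⇒∃≤¬ x∉⋂)
      (⋃≤-NC K p Z (λ i x → ¬ Y i x) (dependsOnlyFrom-∁ ∘ Y-local) Z≤Y)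

  ⋃≤-isSup : ∀ K (p : Fin (suc K)) (Y : ℕ → Sub (suc (suc K))) →
    (∀ i → DependsOnlyFrom (suc (toℕ p)) (Y i)) → IsSup K Y (⋃≤ Y (coordinate p))
  ⋃≤-isSup K p Y Y-local = upperBound , least
    where
    ⋃Y : Sub (suc (suc K))
    ⋃Y = ⋃≤ Y (coordinate p)
    upperBound : ∀ n → Leq K (Y n) ⋃Y
    upperBound n = NC-mono (Diff (Y n) ⋃Y) (λ x → coordinate p x < n)
      (λ _ (y , x∉⋃) → ≰⇒> λ n≤x → x∉⋃ (n , n≤x , y)) (coordinate<-NC K (inject₁ p) n)
    least : ∀ Z → (∀ n → Leq K (Y n) Z) → Leq K ⋃Y Z
    least Z Y≤Z = NC-mono (Diff ⋃Y Z) ((λ x → ¬ Z x) ∩ ⋃Y) (λ _ (u , z) → z , u)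
      (⋃≤-NC K p (λ x → ¬ Z x) Y Y-local λ i →
        NC-mono ((λ x → ¬ Z x) ∩ Y i) (Diff (Y i) Z) (λ _ (z , y) → y , z) (Y≤Z i))

  -- Coprod K l (Bset (suc d) b A) is definitionally ⋂≤ Y (coordinate (l zero)) (b = true) or
  -- ⋃≤ Y (coordinate (l zero)) (b = false), with Y as below.
  Coprod-denotes : ∀ K d b (A : Vec ℕ d → ℕ → Set) (l : Fin d → Fin (suc K)) → StrictlyIncreasing l →
    Denotes K d b A (Coprod K l (Bset d b A))
  Coprod-denotes K zero b A l _ = Leq-refl K {Base K (A [])} , Leq-refl K {Base K (A [])}
  Coprod-denotes K (suc d) true A l l-increasing =
    Y , (λ n → Coprod-denotes K d false (λ ns → A (n ∷ ns)) (l ∘ suc) (strictlyIncreasing-tail l-increasing)) ,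
    ⋂≤-isInf K (l zero) Y (λ i → Coprod-tail-dependsOnlyFrom K l l-increasing (Bset d false (λ ns → A (i ∷ ns))))
    where
    Y : ℕ → Sub (suc (suc K))
    Y n = Coprod K (l ∘ suc) (Bset d false (λ ns → A (n ∷ ns)))
  Coprod-denotes K (suc d) false A l l-increasing =
    Y , (λ n → Coprod-denotes K d true (λ ns → A (n ∷ ns)) (l ∘ suc) (strictlyIncreasing-tail l-increasing)) ,
    ⋃≤-isSup K (l zero) Y (λ i → Coprod-tail-dependsOnlyFrom K l l-increasing (Bset d true (λ ns → A (i ∷ ns))))
    where
    Y : ℕ → Sub (suc (suc K))
    Y n = Coprod K (l ∘ suc) (Bset d true (λ ns → A (n ∷ ns)))

lowerExcludedMiddle : ExcludedMiddle (lsuc 0ℓ) → ExcludedMiddle 0ℓ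
lowerExcludedMiddle em = map′ lower lift em

theorem3p7 : ExcludedMiddle (lsuc 0ℓ) →
    (K j : ℕ) → 1 ≤ j → j < suc (suc K) →
    (l : Fin j → Fin (suc K)) → (∀ a b → a <ᶠ b → l a <ᶠ l b) →
    (A : Vec ℕ j → ℕ → Set) → (∀ ns → Infinite (A ns)) →
    Denotes K j true A (Coprod K l (Bset j true A))
theorem3p7 em K j _ _ l l-increasing A _ =
  InfSup.Coprod-denotes (lowerExcludedMiddle em) K j true A l l-increasing
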